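{- Let $k\geq 4$ and $h\geq 2$ be integers and let $G$ be an ordered additive abelian group with order $\preceq$. Suppose $a_1,\dots,a_{k-3}\in G$ satisfy $0\prec a_1\prec a_2\prec\cdots\prec a_{k-3}$. Let $b,c\in G$ with $0\prec b$ and $0\prec c$, and suppose $c\neq db$ for every positive integer $d$. If $$A=\{0,a_1,a_2,\dots,a_{k-3},\,a_{k-3}+b,\,a_{k-3}+b+c\},$$ then $hA$ has at least $h-1$ nontrivial elements.
   Context: An ordered additive abelian group is an additive abelian group $G$ with a total order $\preceq$ such that for all $x,y,z\in G$, $x\prec y$ implies $x+z\prec y+z$ (here $\prec$ means $\preceq$ and $\neq$). For an integer $h\geq 2$ and $A\subseteq G$, the $h$-fold sumset is $hA=\{x_1+\cdots+x_h : x_1,\dots,x_h\in A\}$. For a positive integer $n$, $ng$ denotes the sum of $n$ copies of $g$. If $A=\{x_1,\dots,x_m\}$ with $x_1\prec x_2\prec\cdots\prec x_m$, an element of $hA$ is called trivial (with respect to $A$) if it equals $(h-i)x_j+ix_{j+1}$ for some integers $0\leq i\leq h$ and $1\leq j\leq m-1$; otherwise it is called nontrivial. (There are exactly $hm-h+1$ trivial elements.) -}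

module Defs where

open import Level using (Level; suc; _⊔_)
open import Data.Nat as ℕ using (ℕ; zero; _≤?_; _∸_)
import Data.Nat
open import Data.Fin using (Fin)
open import Data.Product using (Σ; ∃; _×_)
open import Relation.Nullary using (¬_; yes; no)
open import Relation.Binary.PropositionalEquality using (_≡_; _≢_)
open import Relation.Binary.Structures using (IsTotalOrder)

record OrderedAbelianGroup (c ℓ : Level) : Set (suc (c ⊔ ℓ)) where
  infixl 6 _+_
  infix 4 _≼_ _≺_
  field
    Carrier : Set c
    _+_     : Carrier → Carrier → Carrier
    0#      : Carrier
    -_      : Carrier → Carrier
    +-assoc : ∀ x y z → (x + y) + z ≡ x + (y + z)
    +-comm  : ∀ x y → x + y ≡ y + x
    +-identityˡ : ∀ x → 0# + x ≡ x
    -‿inverseˡ : ∀ x → (- x) + x ≡ 0#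
    _≼_     : Carrier → Carrier → Set ℓ
    isTotalOrder : IsTotalOrder _≡_ _≼_

  _≺_ : Carrier → Carrier → Set (c ⊔ ℓ)
  x ≺ y = (x ≼ y) × (x ≢ y)

  field
    +-mono-≺ : ∀ {x y} z → x ≺ y → x + z ≺ y + z

  mul : ℕ → Carrier → Carrier
  mul zero    g = 0#
  mul (ℕ.suc n) g = g + mul n g

  sumFin : ∀ {h} → (Fin h → Carrier) → Carrier
  sumFin {zero}    f = 0#
  sumFin {ℕ.suc h} f = f Fin.zero + sumFin (λ t → f (Fin.suc t))
    where import Data.Fin as Fin

  InSumset : (h m : ℕ) → (ℕ → Carrier) → Carrier → Set c
  InSumset h m x y =
    Σ (Fin h → ℕ) λ f → (∀ t → f t Data.Nat.< m) × (y ≡ sumFin (λ t → x (f t)))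

  -- trivial element w.r.t. the increasing enumeration x 0 ≺ ... ≺ x (m-1):
  -- y = (h - i) x_j + i x_(j+1) with 0 ≤ i ≤ h and j+1 < m
  Trivial : (h m : ℕ) → (ℕ → Carrier) → Carrier → Set c
  Trivial h m x y =
    Σ ℕ λ j → Σ ℕ λ i → (ℕ.suc j Data.Nat.< m) × (i Data.Nat.≤ h) ×
      (y ≡ mul (h ∸ i) (x j) + mul i (x (ℕ.suc j)))

  -- The set A = {0, a_1, ..., a_(k-3), a_(k-3)+b, a_(k-3)+b+c}, enumerated
  -- in increasing order with indices 0 .. k-1:
  -- index 0 ↦ 0, index j (1 ≤ j ≤ k-3) ↦ a j,
  -- index k-2 ↦ a_(k-3) + b, index ≥ k-1 ↦ a_(k-3) + b + c
  -- (only indices < k are used).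
  elemA : (k : ℕ) → (ℕ → Carrier) → Carrier → Carrier → ℕ → Carrier
  elemA k a b c zero = 0#
  elemA k a b c (ℕ.suc j) with ℕ.suc j ≤? k ∸ 3 | ℕ.suc j ≤? k ∸ 2
  ... | yes _ | _     = a (ℕ.suc j)
  ... | no _  | yes _ = a (k ∸ 3) + b
  ... | no _  | no _  = a (k ∸ 3) + b + c

{-# OPTIONS --safe #-}
-- Write u ≺ y ≺ z for the three largest elements of A, so y = u + b and z = y + c.
-- Listed segment by segment, the trivial elements (h − i) x_j + i x_(j+1) of hA form
-- a weakly increasing sequence, so an element strictly between two consecutive ones
-- is nontrivial. If c ≺ b then u + y ≺ u + z ≺ y + y, so for m + j = h − 2 the element
-- m u + j y + (u + z) lies strictly between (m+1) u + (j+1) y and m u + (j+2) y.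
-- If b ≺ c then y + y ≺ u + z ≺ y + z, and m y + j z + (u + z) lies strictly between
-- (m+2) y + j z and (m+1) y + (j+1) z. In both cases these h − 1 elements increase
-- with j, so they are distinct.
module Submission where

open import Defs
open import Level using (_⊔_)
open import Data.Nat as ℕ using (ℕ; zero; suc; _≤_; _<_; _∸_; z≤n; s≤s; _≤?_)
open import Data.Nat.Properties as ℕₚ
  using ( +-suc; +-cancelʳ-≡; m∸n+n≡m; ≤-refl; ≤-reflexive; ≤-trans; ≤-antisym; ≤-pred
        ; <-trans; <⇒≤; ≰⇒>; n≮n; <-cmp; m≤n⇒m<n∨m≡n )
open import Data.Fin using () renaming (zero to fzero; suc to fsuc)
open import Data.Vec.Functional using (_∷_)
open import Data.List using (List; length; applyUpTo)
import Data.List.Properties as List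
open import Data.List.Relation.Unary.All using (All)
import Data.List.Relation.Unary.All.Properties as All
open import Data.List.Relation.Unary.Unique.Propositional using (Unique)
import Data.List.Relation.Unary.Unique.Propositional.Properties as Unique
open import Data.Product using (Σ; _×_; _,_; proj₁; proj₂)
open import Data.Sum using (_⊎_; inj₁; inj₂; [_,_]′)
open import Relation.Nullary using (¬_; yes; no; contradiction)
open import Relation.Binary.PropositionalEquality
  using (_≡_; _≢_; refl; sym; trans; cong; cong₂; subst; subst₂; isEquivalence)
open import Relation.Binary.Bundles using (StrictPartialOrder)
open import Relation.Binary.Structures using (IsTotalOrder)
open import Relation.Binary.Definitions using (tri<; tri≈; tri>)
import Relation.Binary.Construct.NonStrictToStrict as NonStrictToStrict
import Relation.Binary.Construct.StrictToNonStrict as StrictToNonStrict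
import Relation.Binary.Reasoning.StrictPartialOrder as StrictReasoning
open import Algebra.Bundles using (CommutativeMonoid)

m∸n+[1+n]≡1+m : ∀ {m n} → n ≤ m → m ∸ n ℕ.+ suc n ≡ suc m
m∸n+[1+n]≡1+m {m} {n} n≤m = trans (+-suc (m ∸ n) n) (cong suc (m∸n+n≡m n≤m))

module OrderedAbelianGroupProperties {c ℓ} (G : OrderedAbelianGroup c ℓ) where
  open OrderedAbelianGroup G
  open IsTotalOrder isTotalOrder using (isPartialOrder; total)

  ≺-strictPartialOrder : StrictPartialOrder c c (c ⊔ ℓ)
  ≺-strictPartialOrder = record
    { isStrictPartialOrder = NonStrictToStrict.<-isStrictPartialOrder _≡_ _≼_ isPartialOrder }

  open StrictPartialOrder ≺-strictPartialOrder public
    using () renaming (irrefl to ≺-irrefl; asym to ≺-asym)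

  module ≺-Reasoning = StrictReasoning ≺-strictPartialOrder

  -- Constructively ≼ is not known to be translation invariant (that would need
  -- decidable equality on the carrier), so we work with "≺ or ≡" instead.
  infix 4 _⊑_
  _⊑_ : Carrier → Carrier → Set (c ⊔ ℓ)
  _⊑_ = StrictToNonStrict._≤_ _≡_ _≺_

  ≺⇒⋢ : ∀ {x y} → x ≺ y → ¬ (y ⊑ x)
  ≺⇒⋢ x≺y (inj₁ y≺x)  = ≺-asym x≺y y≺x
  ≺⇒⋢ x≺y (inj₂ refl) = ≺-irrefl refl x≺y

  ≢⇒≺⊎≻ : ∀ {x y} → x ≢ y → x ≺ y ⊎ y ≺ x
  ≢⇒≺⊎≻ {x} {y} x≢y with total x y
  ... | inj₁ x≼y = inj₁ (x≼y , x≢y)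
  ... | inj₂ y≼x = inj₂ (y≼x , λ y≡x → x≢y (sym y≡x))

  commutativeMonoid : CommutativeMonoid c c
  commutativeMonoid = record
    { isCommutativeMonoid = record
      { isMonoid = record
        { isSemigroup = record
          { isMagma = record { isEquivalence = isEquivalence ; ∙-cong = cong₂ _+_ }
          ; assoc = +-assoc }
        ; identity = +-identityˡ , λ x → trans (+-comm x 0#) (+-identityˡ x) }
      ; comm = +-comm } }

  open CommutativeMonoid commutativeMonoid public using (identityʳ)
  open import Algebra.Solver.CommutativeMonoid commutativeMonoid public using (solve; _⊜_; _⊕_)

  +-monoʳ-≺ : ∀ {x y} z → x ≺ y → z + x ≺ z + y
  +-monoʳ-≺ {x} {y} z x≺y = subst₂ _≺_ (+-comm x z) (+-comm y z) (+-mono-≺ z x≺y)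

  +-monoˡ-⊑ : ∀ {x y} z → x ⊑ y → x + z ⊑ y + z
  +-monoˡ-⊑ z (inj₁ x≺y) = inj₁ (+-mono-≺ z x≺y)
  +-monoˡ-⊑ z (inj₂ refl) = inj₂ refl

  +-monoʳ-⊑ : ∀ {x y} z → x ⊑ y → z + x ⊑ z + y
  +-monoʳ-⊑ z (inj₁ x≺y) = inj₁ (+-monoʳ-≺ z x≺y)
  +-monoʳ-⊑ z (inj₂ refl) = inj₂ refl

  +-mono-⊑ : ∀ {x y u v} → x ⊑ y → u ⊑ v → x + u ⊑ y + v
  +-mono-⊑ {x} {y} {u} {v} x⊑y u⊑v = begin
    x + u  ≤⟨ +-monoˡ-⊑ u x⊑y ⟩
    y + u  ≤⟨ +-monoʳ-⊑ y u⊑v ⟩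
    y + v  ∎
    where open ≺-Reasoning

  x≺x+y : ∀ {x y} → 0# ≺ y → x ≺ x + y
  x≺x+y {x} {y} 0≺y = subst (_≺ x + y) (identityʳ x) (+-monoʳ-≺ x 0≺y)

  mul-+ : ∀ m n g → mul (m ℕ.+ n) g ≡ mul m g + mul n g
  mul-+ zero    n g = sym (+-identityˡ (mul n g))
  mul-+ (suc m) n g = trans (cong (g +_) (mul-+ m n g)) (sym (+-assoc g (mul m g) (mul n g)))

  mul-mono-⊑ : ∀ n {p q} → p ⊑ q → mul n p ⊑ mul n q
  mul-mono-⊑ zero    p⊑q = inj₂ refl
  mul-mono-⊑ (suc n) p⊑q = +-mono-⊑ p⊑q (mul-mono-⊑ n p⊑q)

  comb : Carrier → Carrier → ℕ → ℕ → Carrier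
  comb p q m i = mul m p + mul i q

  comb-suc-suc : ∀ p q m i → comb p q (suc m) (suc i) ≡ comb p q m i + (p + q)
  comb-suc-suc p q m i =
    solve 4 (λ p q M I → (p ⊕ M) ⊕ (q ⊕ I) ⊜ (M ⊕ I) ⊕ (p ⊕ q)) refl p q (mul m p) (mul i q)

  comb-2+ˡ : ∀ p q m i → comb p q (2 ℕ.+ m) i ≡ comb p q m i + (p + p)
  comb-2+ˡ p q m i =
    solve 3 (λ p M I → (p ⊕ (p ⊕ M)) ⊕ I ⊜ (M ⊕ I) ⊕ (p ⊕ p)) refl p (mul m p) (mul i q)

  comb-2+ʳ : ∀ p q m i → comb p q m (2 ℕ.+ i) ≡ comb p q m i + (q + q)
  comb-2+ʳ p q m i =
    solve 3 (λ q M I → M ⊕ (q ⊕ (q ⊕ I)) ⊜ (M ⊕ I) ⊕ (q ⊕ q)) refl q (mul m p) (mul i q)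

  module _ {p q : Carrier} (p⊑q : p ⊑ q) where

    comb-step : ∀ m i → comb p q (suc m) i ⊑ comb p q m (suc i)
    comb-step m i = begin
      (p + mul m p) + mul i q  ≡⟨ +-assoc p (mul m p) (mul i q) ⟩
      p + comb p q m i         ≤⟨ +-monoˡ-⊑ (comb p q m i) p⊑q ⟩
      q + comb p q m i         ≡⟨ swap q (mul m p) (mul i q) ⟩
      mul m p + (q + mul i q)  ∎
      where
      open ≺-Reasoning
      swap : ∀ q M I → q + (M + I) ≡ M + (q + I)
      swap = solve 3 (λ q M I → q ⊕ (M ⊕ I) ⊜ M ⊕ (q ⊕ I)) refl

    comb-mono : ∀ m i m′ i′ → m ℕ.+ i ≡ m′ ℕ.+ i′ → i ≤ i′ →
                comb p q m i ⊑ comb p q m′ i′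
    comb-mono m i m′ i′ e i≤i′ with m≤n⇒m<n∨m≡n i≤i′
    ... | inj₂ refl = inj₂ (cong (λ m → comb p q m i) (+-cancelʳ-≡ i m m′ e))
    ... | inj₁ (s≤s {n = i″} i≤i″) = begin
      comb p q m i          ≤⟨ comb-mono m i (suc m′) i″ (trans e (+-suc m′ i″)) i≤i″ ⟩
      comb p q (suc m′) i″  ≤⟨ comb-step m′ i″ ⟩
      comb p q m′ (suc i″)  ∎
      where open ≺-Reasoning

    comb-⊑-mul : ∀ m i → comb p q m i ⊑ mul (m ℕ.+ i) q
    comb-⊑-mul m i =
      subst (comb p q m i ⊑_) (sym (mul-+ m i q)) (+-monoˡ-⊑ (mul i q) (mul-mono-⊑ m p⊑q))

    mul-⊑-comb : ∀ m i → mul (m ℕ.+ i) p ⊑ comb p q m i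
    mul-⊑-comb m i =
      subst (_⊑ comb p q m i) (sym (mul-+ m i p)) (+-monoʳ-⊑ (mul m p) (mul-mono-⊑ i p⊑q))

  AtLeastNontrivial : (n h k : ℕ) → (ℕ → Carrier) → Set c
  AtLeastNontrivial n h k x = Σ (List Carrier) λ ys →
    (n ≤ length ys) × Unique ys × All (λ y → InSumset h k x y × ¬ Trivial h k x y) ys

  module _ {k : ℕ} {x : ℕ → Carrier} where

    inSumset-∷ : ∀ {h y j} → j < k → InSumset h k x y → InSumset (suc h) k x (x j + y)
    inSumset-∷ {j = j} j<k (f , f<k , y≡) =
      (j ∷ f) , (λ { fzero → j<k ; (fsuc t) → f<k t }) , cong (x j +_) y≡

    inSumset-+ : ∀ {h h′ y y′} → InSumset h k x y → InSumset h′ k x y′ →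
                 InSumset (h ℕ.+ h′) k x (y + y′)
    inSumset-+ {zero} {y′ = y′} (_ , _ , refl) y′∈ =
      subst (InSumset _ k x) (sym (+-identityˡ y′)) y′∈
    inSumset-+ {suc h} {y′ = y′} (f , f<k , refl) y′∈ =
      subst (InSumset _ k x) (sym (+-assoc (x (f fzero)) _ y′))
        (inSumset-∷ (f<k fzero)
          (inSumset-+ ((λ t → f (fsuc t)) , (λ t → f<k (fsuc t)) , refl) y′∈))

    inSumset-mul : ∀ n {j} → j < k → InSumset n k x (mul n (x j))
    inSumset-mul zero    j<k = (λ ()) , (λ ()) , refl
    inSumset-mul (suc n) j<k = inSumset-∷ j<k (inSumset-mul n j<k)

    inSumset-comb : ∀ m n {i j} → i < k → j < k →
                    InSumset (m ℕ.+ n) k x (comb (x i) (x j) m n)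
    inSumset-comb m n i<k j<k = inSumset-+ (inSumset-mul m i<k) (inSumset-mul n j<k)

    inSumset-pair : ∀ {i j} → i < k → j < k → InSumset 2 k x (x i + x j)
    inSumset-pair {i} {j} i<k j<k =
      subst (λ w → InSumset 2 k x (x i + w)) (identityʳ (x j)) (inSumset-∷ i<k (inSumset-mul 1 j<k))

  module _ {k : ℕ} {x : ℕ → Carrier} (x-mono : ∀ j → suc j < k → x j ⊑ x (suc j)) where

    x-mono-≤ : ∀ {i j} → i ≤ j → j < k → x i ⊑ x j
    x-mono-≤ {i} {j} i≤j j<k with m≤n⇒m<n∨m≡n i≤j
    ... | inj₂ refl = inj₂ refl
    ... | inj₁ (s≤s {n = j′} i≤j′) = begin
      x i         ≤⟨ x-mono-≤ i≤j′ (<⇒≤ j<k) ⟩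
      x j′        ≤⟨ x-mono j′ j<k ⟩
      x (suc j′)  ∎
      where open ≺-Reasoning

    -- The trivial elements of hA are the seg j (h ∸ i) i with i ≤ h and suc j < k.
    seg : ℕ → ℕ → ℕ → Carrier
    seg j = comb (x j) (x (suc j))

    seg-mono : ∀ {j j′} m i m′ i′ → j < j′ → suc j′ < k → m ℕ.+ i ≡ m′ ℕ.+ i′ →
               seg j m i ⊑ seg j′ m′ i′
    seg-mono {j} {j′} m i m′ i′ j<j′ j′<k e = begin
      seg j m i                  ≤⟨ comb-⊑-mul (x-mono j (≤-trans (s≤s j<j′) (<⇒≤ j′<k))) m i ⟩
      mul (m ℕ.+ i) (x (suc j))  ≤⟨ mul-mono-⊑ (m ℕ.+ i) (x-mono-≤ j<j′ (<⇒≤ j′<k)) ⟩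
      mul (m ℕ.+ i) (x j′)       ≡⟨ cong (λ n → mul n (x j′)) e ⟩
      mul (m′ ℕ.+ i′) (x j′)     ≤⟨ mul-⊑-comb (x-mono j′ j′<k) m′ i′ ⟩
      seg j′ m′ i′               ∎
      where open ≺-Reasoning

    strictlyBetween⇒≢seg : ∀ {J M I s j m i} → suc J < k → suc j < k →
      m ℕ.+ i ≡ suc M ℕ.+ I → M ℕ.+ suc I ≡ m ℕ.+ i →
      seg J (suc M) I ≺ s → s ≺ seg J M (suc I) → s ≢ seg j m i
    strictlyBetween⇒≢seg {J} {M} {I} {j = j} {m} {i} J<k j<k t≡lower upper≡t lower≺s s≺upper refl
      with <-cmp j J
    ... | tri< j<J _ _ = ≺⇒⋢ lower≺s (seg-mono m i (suc M) I j<J J<k t≡lower)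
    ... | tri> _ _ J<j = ≺⇒⋢ s≺upper (seg-mono M (suc I) m i J<j j<k upper≡t)
    ... | tri≈ _ refl _ with i ≤? I
    ...   | yes i≤I = ≺⇒⋢ lower≺s (comb-mono (x-mono J J<k) m i (suc M) I t≡lower i≤I)
    ...   | no i≰I  = ≺⇒⋢ s≺upper (comb-mono (x-mono J J<k) M (suc I) m i upper≡t (≰⇒> i≰I))

    strictlyBetween⇒¬Trivial : ∀ {h J M I s} → suc J < k → M ℕ.+ suc I ≡ h →
      seg J (suc M) I ≺ s → s ≺ seg J M (suc I) → ¬ Trivial h k x s
    strictlyBetween⇒¬Trivial {h} {M = M} {I} J<k size lower≺s s≺upper (j , i , j<k , i≤h , s≡t) =
      strictlyBetween⇒≢seg {m = h ∸ i} {i} J<k j<k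
        (trans (m∸n+n≡m i≤h) (trans (sym size) (+-suc M I))) (trans size (sym (m∸n+n≡m i≤h)))
        lower≺s s≺upper s≡t

    strictlyBetween⇒nontrivials : ∀ {h J} n (s : ℕ → Carrier) (M I : ℕ → ℕ) → suc J < k →
      (∀ {j} → j < n → M j ℕ.+ suc (I j) ≡ h) →
      (∀ {i j} → i < j → I i < I j) →
      (∀ {j} → j < n → seg J (suc (M j)) (I j) ≺ s j × s j ≺ seg J (M j) (suc (I j))) →
      (∀ {j} → j < n → InSumset h k x (s j)) →
      AtLeastNontrivial n h k x
    strictlyBetween⇒nontrivials {h} {J} n s M I J<k size I-mono between s∈ =
      applyUpTo s n ,
      ≤-reflexive (sym (List.length-applyUpTo s n)) ,
      Unique.applyUpTo⁺₁ s n (λ i<j j<n → proj₂ (s-increasing i<j j<n)) ,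
      All.applyUpTo⁺₁ s n (λ j<n →
        s∈ j<n , strictlyBetween⇒¬Trivial J<k (size j<n) (proj₁ (between j<n)) (proj₂ (between j<n)))
      where
      s-increasing : ∀ {i j} → i < j → j < n → s i ≺ s j
      s-increasing {i} {j} i<j j<n = begin-strict
        s i                      <⟨ proj₂ (between i<n) ⟩
        seg J (M i) (suc (I i))  ≤⟨ comb-mono (x-mono J J<k) (M i) (suc (I i)) (suc (M j)) (I j)
                                      (trans (size i<n) (trans (sym (size j<n)) (+-suc (M j) (I j))))
                                      (I-mono i<j) ⟩
        seg J (suc (M j)) (I j)  <⟨ proj₁ (between j<n) ⟩
        s j                      ∎
        where
        open ≺-Reasoning
        i<n : i < n
        i<n = <-trans i<j j<n

    inSumset-seg-+ : ∀ {J w r j} → suc J < k → InSumset 2 k x w → j ≤ r →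
                     InSumset (2 ℕ.+ r) k x (seg J (r ∸ j) j + w)
    inSumset-seg-+ {J} {w} {r} {j} J<k w∈ j≤r =
      subst (λ h → InSumset h k x (seg J (r ∸ j) j + w))
        (trans (ℕₚ.+-comm (r ∸ j ℕ.+ j) 2) (cong (2 ℕ.+_) (m∸n+n≡m j≤r)))
        (inSumset-+ {x = x} (inSumset-comb (r ∸ j) j (<⇒≤ J<k) J<k) w∈)

    between-pq-qq⇒nontrivials : ∀ {J w} r → suc J < k → InSumset 2 k x w →
      x J + x (suc J) ≺ w → w ≺ x (suc J) + x (suc J) → AtLeastNontrivial (suc r) (2 ℕ.+ r) k x
    between-pq-qq⇒nontrivials {J} {w} r J<k w∈ pq≺w w≺qq =
      strictlyBetween⇒nontrivials (suc r) s (r ∸_) suc J<k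
        (λ {j} j<1+r → trans (+-suc (r ∸ j) (suc j)) (cong suc (m∸n+[1+n]≡1+m (≤-pred j<1+r))))
        s≤s between (λ j<1+r → inSumset-seg-+ J<k w∈ (≤-pred j<1+r))
      where
      open ≺-Reasoning
      s : ℕ → Carrier
      s j = seg J (r ∸ j) j + w
      between : ∀ {j} → j < suc r →
                seg J (suc (r ∸ j)) (suc j) ≺ s j × s j ≺ seg J (r ∸ j) (2 ℕ.+ j)
      between {j} _ =
        (begin-strict
          seg J (suc (r ∸ j)) (suc j)          ≡⟨ comb-suc-suc (x J) (x (suc J)) (r ∸ j) j ⟩
          seg J (r ∸ j) j + (x J + x (suc J))  <⟨ +-monoʳ-≺ (seg J (r ∸ j) j) pq≺w ⟩
          s j                                  ∎) ,
        (begin-strict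
          s j                                        <⟨ +-monoʳ-≺ (seg J (r ∸ j) j) w≺qq ⟩
          seg J (r ∸ j) j + (x (suc J) + x (suc J))  ≡⟨ comb-2+ʳ (x J) (x (suc J)) (r ∸ j) j ⟨
          seg J (r ∸ j) (2 ℕ.+ j)                    ∎)

    between-pp-pq⇒nontrivials : ∀ {J w} r → suc J < k → InSumset 2 k x w →
      x J + x J ≺ w → w ≺ x J + x (suc J) → AtLeastNontrivial (suc r) (2 ℕ.+ r) k x
    between-pp-pq⇒nontrivials {J} {w} r J<k w∈ pp≺w w≺pq =
      strictlyBetween⇒nontrivials (suc r) s (λ j → suc (r ∸ j)) (λ j → j) J<k
        (λ j<1+r → cong suc (m∸n+[1+n]≡1+m (≤-pred j<1+r)))
        (λ i<j → i<j) between (λ j<1+r → inSumset-seg-+ J<k w∈ (≤-pred j<1+r))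
      where
      open ≺-Reasoning
      s : ℕ → Carrier
      s j = seg J (r ∸ j) j + w
      between : ∀ {j} → j < suc r →
                seg J (2 ℕ.+ (r ∸ j)) j ≺ s j × s j ≺ seg J (suc (r ∸ j)) (suc j)
      between {j} _ =
        (begin-strict
          seg J (2 ℕ.+ (r ∸ j)) j          ≡⟨ comb-2+ˡ (x J) (x (suc J)) (r ∸ j) j ⟩
          seg J (r ∸ j) j + (x J + x J)  <⟨ +-monoʳ-≺ (seg J (r ∸ j) j) pp≺w ⟩
          s j                            ∎) ,
        (begin-strict
          s j                                  <⟨ +-monoʳ-≺ (seg J (r ∸ j) j) w≺pq ⟩
          seg J (r ∸ j) j + (x J + x (suc J))  ≡⟨ comb-suc-suc (x J) (x (suc J)) (r ∸ j) j ⟨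
          seg J (suc (r ∸ j)) (suc j)          ∎)

    unequalGaps⇒nontrivials : ∀ {J b c} r → suc (suc J) < k → 0# ≺ b → 0# ≺ c → c ≢ b →
      x (suc J) ≡ x J + b → x (suc (suc J)) ≡ x (suc J) + c →
      AtLeastNontrivial (suc r) (2 ℕ.+ r) k x
    unequalGaps⇒nontrivials {J} {b} {c} r J+2<k 0≺b 0≺c c≢b y≡u+b z≡y+c =
      [ smallerSecondGap , largerSecondGap ]′ (≢⇒≺⊎≻ c≢b)
      where
      open ≺-Reasoning
      u y z : Carrier
      u = x J
      y = x (suc J)
      z = x (suc (suc J))
      u≺y : u ≺ y
      u≺y = subst (u ≺_) (sym y≡u+b) (x≺x+y 0≺b)
      y≺z : y ≺ z
      y≺z = subst (y ≺_) (sym z≡y+c) (x≺x+y 0≺c)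
      u+z≡y+[u+c] : u + z ≡ y + (u + c)
      u+z≡y+[u+c] =
        trans (cong (u +_) z≡y+c) (solve 3 (λ u y c → u ⊕ (y ⊕ c) ⊜ y ⊕ (u ⊕ c)) refl u y c)
      w∈ : InSumset 2 k x (u + z)
      w∈ = inSumset-pair {x = x} (<⇒≤ (<⇒≤ J+2<k)) J+2<k
      smallerSecondGap : c ≺ b → AtLeastNontrivial (suc r) (2 ℕ.+ r) k x
      smallerSecondGap c≺b =
        between-pq-qq⇒nontrivials r (<⇒≤ J+2<k) w∈ (+-monoʳ-≺ u y≺z) (begin-strict
          u + z        ≡⟨ u+z≡y+[u+c] ⟩
          y + (u + c)  <⟨ +-monoʳ-≺ y (+-monoʳ-≺ u c≺b) ⟩
          y + (u + b)  ≡⟨ cong (y +_) y≡u+b ⟨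
          y + y        ∎)
      largerSecondGap : b ≺ c → AtLeastNontrivial (suc r) (2 ℕ.+ r) k x
      largerSecondGap b≺c =
        between-pp-pq⇒nontrivials r J+2<k w∈ (begin-strict
          y + y        ≡⟨ cong (y +_) y≡u+b ⟩
          y + (u + b)  <⟨ +-monoʳ-≺ y (+-monoʳ-≺ u b≺c) ⟩
          y + (u + c)  ≡⟨ u+z≡y+[u+c] ⟨
          u + z        ∎) (+-mono-≺ z u≺y)

  module _ (n : ℕ) (a : ℕ → Carrier) (b c : Carrier) where

    elemA-inner : ∀ {j} → 1 ≤ j → j ≤ n → elemA (3 ℕ.+ n) a b c j ≡ a j
    elemA-inner {suc j} _ j≤n with suc j ≤? n | suc j ≤? suc n
    ... | yes _  | _ = refl
    ... | no j≰n | _ = contradiction j≤n j≰n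

    elemA-penultimate : elemA (3 ℕ.+ n) a b c (suc n) ≡ a n + b
    elemA-penultimate with suc n ≤? n | suc n ≤? suc n
    ... | yes n<n | _      = contradiction n<n (n≮n n)
    ... | no _    | yes _  = refl
    ... | no _    | no n≰n = contradiction ≤-refl n≰n

    elemA-last : elemA (3 ℕ.+ n) a b c (2 ℕ.+ n) ≡ a n + b + c
    elemA-last with 2 ℕ.+ n ≤? n | 2 ℕ.+ n ≤? suc n
    ... | yes 2+n≤n | _       = contradiction (<⇒≤ 2+n≤n) (n≮n n)
    ... | no _      | yes n<n = contradiction n<n (n≮n (suc n))
    ... | no _      | no _    = refl

    elemA-increasing : 1 ≤ n → 0# ≺ a 1 → (∀ i → 1 ≤ i → suc i ≤ n → a i ≺ a (suc i)) →
      0# ≺ b → 0# ≺ c → ∀ j → suc j < 3 ℕ.+ n →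
      elemA (3 ℕ.+ n) a b c j ≺ elemA (3 ℕ.+ n) a b c (suc j)
    elemA-increasing 1≤n 0≺a₁ a-inc 0≺b 0≺c zero _ =
      subst (0# ≺_) (sym (elemA-inner ≤-refl 1≤n)) 0≺a₁
    elemA-increasing 1≤n 0≺a₁ a-inc 0≺b 0≺c (suc j) 2+j<3+n with <-cmp (suc j) n
    ... | tri< 1+j<n _ _ =
      subst₂ _≺_ (sym (elemA-inner (s≤s z≤n) (<⇒≤ 1+j<n))) (sym (elemA-inner (s≤s z≤n) 1+j<n))
        (a-inc (suc j) (s≤s z≤n) 1+j<n)
    ... | tri≈ _ refl _ =
      subst₂ _≺_ (sym (elemA-inner 1≤n ≤-refl)) (sym elemA-penultimate) (x≺x+y 0≺b)
    ... | tri> _ _ n<1+j rewrite ≤-antisym (≤-pred (≤-pred (≤-pred 2+j<3+n))) (≤-pred n<1+j) =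
      subst₂ _≺_ (sym elemA-penultimate) (sym elemA-last) (x≺x+y 0≺c)

theorem3p3 : ∀ {c ℓ} (G : OrderedAbelianGroup c ℓ) → let open OrderedAbelianGroup G in
    (k h : ℕ) → 4 ≤ k → 2 ≤ h →
    (a : ℕ → Carrier) →
    0# ≺ a 1 →
    (∀ i → 1 ≤ i → suc i ≤ k ∸ 3 → a i ≺ a (suc i)) →
    (b c : Carrier) → 0# ≺ b → 0# ≺ c →
    (∀ d → 1 ≤ d → c ≢ mul d b) →
    Σ (List Carrier) λ ys →
      (h ∸ 1 ≤ length ys) × Unique ys ×
      All (λ y → InSumset h k (elemA k a b c) y × ¬ Trivial h k (elemA k a b c) y) ys
theorem3p3 G (suc (suc (suc (suc n)))) (suc (suc r)) (s≤s (s≤s (s≤s (s≤s z≤n)))) (s≤s (s≤s z≤n))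
           a 0≺a₁ a-inc b c 0≺b 0≺c c≢db =
  unequalGaps⇒nontrivials A-mono r ≤-refl 0≺b 0≺c c≢b gap-b gap-c
  where
  open OrderedAbelianGroup G
  open OrderedAbelianGroupProperties G
  A : ℕ → Carrier
  A = elemA (4 ℕ.+ n) a b c
  A-mono : ∀ j → suc j < 4 ℕ.+ n → A j ⊑ A (suc j)
  A-mono j j<k = inj₁ (elemA-increasing (suc n) a b c (s≤s z≤n) 0≺a₁ a-inc 0≺b 0≺c j j<k)
  gap-b : A (2 ℕ.+ n) ≡ A (suc n) + b
  gap-b = trans (elemA-penultimate (suc n) a b c)
                (cong (_+ b) (sym (elemA-inner (suc n) a b c (s≤s z≤n) ≤-refl)))
  gap-c : A (3 ℕ.+ n) ≡ A (2 ℕ.+ n) + c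
  gap-c = trans (elemA-last (suc n) a b c) (cong (_+ c) (sym (elemA-penultimate (suc n) a b c)))
  -- Of the hypothesis c ≢ d b only the case d = 1 is needed.
  c≢b : c ≢ b
  c≢b c≡b = c≢db 1 (s≤s z≤n) (trans c≡b (sym (identityʳ b)))
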